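{- Let $K$ be a field in which arithmetic operations and equality testing can be carried out effectively (e.g. $K=\mathbb{Q}$). There is an algorithm which, given as input an elliptic curve $E$ over $K$ by a Weierstrass equation $Y^2+a_1XY+a_3Y=X^3+a_2X^2+a_4X+a_6$ with $a_i\in K$, together with an $x$-arithmetic progression on $E$, i.e. elements $x_0,\dots,x_n\in K$ with $x_i=x_0+id$ ($d\neq 0$) such that for every $i$ there is a point of $E(K)$ with $X$-coordinate $x_i$, decides whether or not $E$ has a simultaneous arithmetic progression with support $x_0,\dots,x_n$; that is, whether there exist points $P_0,\dots,P_n\in E(K)$ with $X$-coordinate of $P_i$ equal to $x_i$ and a Weierstrass change of variables $X'=u^2X+s$, $Y'=u^3Y+rX+t$ ($u\in K^\*$, $r,s,t\in K$) such that the images $P_0',\dots,P_n'$ of $P_0,\dots,P_n$ form a simultaneous arithmetic progression on the transformed equation (in which case the algorithm also produces such a change of variables).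
   Context: Points $P_0=(x_0',y_0'),\dots,P_n=(x_n',y_n')$ on a given Weierstrass equation form a simultaneous arithmetic progression (s.a.p.) of length $n+1$ if (a) $x_0',\dots,x_n'$ is an arithmetic progression with nonzero common difference (its support), and (b) there is a permutation $\sigma$ of $\{0,\dots,n\}$ such that $y_{\sigma(0)}',\dots,y_{\sigma(n)}'$ is an arithmetic progression. Note that the property of being an $x$-arithmetic progression is preserved by Weierstrass changes of variables, whereas the $y$-condition depends on the chosen equation. -}

module Defs where

open import Level using (Level; _⊔_) renaming (suc to lsuc)
open import Algebra.Bundles using (CommutativeRing)
open import Data.Nat using (ℕ; zero; suc)
open import Data.Fin using (Fin; toℕ)
open import Data.Fin.Permutation using (Permutation′; _⟨$⟩ʳ_)
open import Data.Product using (Σ; ∃; ∃₂; _×_)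
open import Relation.Nullary using (¬_)

record Field (c ℓ : Level) : Set (lsuc (c ⊔ ℓ)) where
  field
    commutativeRing : CommutativeRing c ℓ
  open CommutativeRing commutativeRing public
  field
    0≉1     : ¬ (0# ≈ 1#)
    inverse : ∀ x → ¬ (x ≈ 0#) → ∃ λ y → x * y ≈ 1#

module EC {c ℓ : Level} (F : Field c ℓ) where
  open Field F

  fromℕ : ℕ → Carrier
  fromℕ zero    = 0#
  fromℕ (suc n) = 1# + fromℕ n

  record Weierstrass : Set c where
    constructor weierstrass
    field
      a₁ a₂ a₃ a₄ a₆ : Carrier

  module _ (W : Weierstrass) where
    open Weierstrass W

    b₂ b₄ b₆ b₈ Δ : Carrier
    b₂ = a₁ * a₁ + fromℕ 4 * a₂
    b₄ = fromℕ 2 * a₄ + a₁ * a₃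
    b₆ = a₃ * a₃ + fromℕ 4 * a₆
    b₈ = a₁ * a₁ * a₆ + fromℕ 4 * a₂ * a₆ - a₁ * a₃ * a₄ + a₂ * a₃ * a₃ - a₄ * a₄
    Δ = (- (b₂ * b₂ * b₈)) - fromℕ 8 * (b₄ * b₄ * b₄) - fromℕ 27 * (b₆ * b₆)
          + fromℕ 9 * (b₂ * b₄ * b₆)

    IsElliptic : Set ℓ
    IsElliptic = ¬ (Δ ≈ 0#)

    OnCurve : Carrier → Carrier → Set ℓ
    OnCurve x y = y * y + a₁ * x * y + a₃ * y ≈ x * x * x + a₂ * x * x + a₄ * x + a₆

  record Change : Set (c ⊔ ℓ) where
    constructor change
    field
      u r s t : Carrier
      u≉0     : ¬ (u ≈ 0#)

  imgX : Change → Carrier → Carrier → Carrier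
  imgX C x y = u * u * x + s where open Change C

  imgY : Change → Carrier → Carrier → Carrier
  imgY C x y = u * u * u * y + r * x + t where open Change C

  IsAP : (n : ℕ) → (Fin (suc n) → Carrier) → Set (c ⊔ ℓ)
  IsAP n v = ∃₂ λ a e → ∀ i → v i ≈ a + fromℕ (toℕ i) * e

  IsAP≠0 : (n : ℕ) → (Fin (suc n) → Carrier) → Set (c ⊔ ℓ)
  IsAP≠0 n v = ∃₂ λ a e → ¬ (e ≈ 0#) × (∀ i → v i ≈ a + fromℕ (toℕ i) * e)

  IsSAP : (n : ℕ) → (xs ys : Fin (suc n) → Carrier) → Set (c ⊔ ℓ)
  IsSAP n xs ys = IsAP≠0 n xs × Σ (Permutation′ (suc n)) λ σ → IsAP n (λ i → ys (σ ⟨$⟩ʳ i))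

  xAt : (x₀ d : Carrier) → {n : ℕ} → Fin (suc n) → Carrier
  xAt x₀ d i = x₀ + fromℕ (toℕ i) * d

  HasSAPWithSupport : Weierstrass → (n : ℕ) → (x₀ d : Carrier) → Set (c ⊔ ℓ)
  HasSAPWithSupport W n x₀ d =
    Σ Change λ C → Σ (Fin (suc n) → Carrier) λ ys →
      (∀ i → OnCurve W (xAt x₀ d i) (ys i)) ×
      IsSAP n (λ i → imgX C (xAt x₀ d i) (ys i)) (λ i → imgY C (xAt x₀ d i) (ys i))

{-# OPTIONS --safe #-}
-- A change of variables maps an x-progression to an x-progression, and
-- Y' = u³ (Y + (r / u³) X) + t, so the images form an s.a.p. exactly when some
-- ordering of the values y_i + ρ x_i (ρ = r / u³) is an arithmetic progression:
-- it suffices to search among the shears X' = X, Y' = Y + ρ X. Over each x_i lie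
-- only the points y_i and -y_i - a₁ x_i - a₃, so there are finitely many choices
-- of points and orderings, and for each of them being a progression is a system
-- of linear equations in ρ, decidable over a field with decidable equality.
module Submission where

open import Defs
open import Level using (_⊔_)
open import Algebra.Bundles using (CommutativeRing)
open import Data.Bool using (Bool; true; false)
open import Data.Nat as ℕ using (ℕ; zero; suc)
import Data.Nat.Properties as ℕ
open import Data.Integer as ℤ using (ℤ; +_; -[1+_]; _⊖_; _◃_)
import Data.Integer.Properties as ℤ
open import Data.Sign as Sign using ()
open import Data.Fin using (Fin; zero; suc; toℕ; punchIn)
open import Data.Fin.Properties using (any?; all?)
open import Data.Fin.Permutation as Perm
  using (Permutation′; _⟨$⟩ʳ_; insert; remove; insert-punchIn; insert-remove)
open import Data.Fin.Subset using (Subset)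
open import Data.Fin.Subset.Properties using (anySubset?)
open import Data.Vec using (lookup; tabulate)
open import Data.Vec.Properties using (lookup∘tabulate)
open import Data.Maybe as Maybe using (Maybe)
open import Data.Product as Product using (Σ; ∃; _,_; proj₁; proj₂)
open import Data.Sum as Sum using (_⊎_; inj₁; inj₂)
open import Function using (_∘_)
open import Relation.Nullary using (¬_; Dec; yes; no)
open import Relation.Nullary.Decidable using (map′; ¬?; decidable-stable; dec⇒maybe)
open import Relation.Binary.Definitions using (Decidable; _Respects_)
import Relation.Binary.PropositionalEquality as ≡
open import Algebra.Solver.Ring.AlmostCommutativeRing
  using (fromCommutativeRing; _-Raw-AlmostCommutative⟶_)
import Algebra.Solver.Ring as RingSolver
import Algebra.Properties.Ring as RingProperties
import Algebra.Properties.Semiring.Mult as SemiringMult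
import Relation.Binary.Reasoning.Setoid as ≈-Reasoning

-- The ring solver evaluates coefficients while normalising, so it needs a
-- coefficient ring whose equality computes: ℤ, through its canonical map into R.
module IntegerCoefficientSolver {c ℓ} (R : CommutativeRing c ℓ) where
  open CommutativeRing R
  open RingProperties ring
    using (-0#≈0#; -‿involutive; -‿distribˡ-*; -‿distribʳ-*; -‿+-comm; xyx⁻¹≈y)
  open SemiringMult semiring using (_×_; ×-homo-+; ×1-homo-*)
  open ≈-Reasoning setoid

  fromℤ : ℤ → Carrier
  fromℤ (+ n)    = n × 1#
  fromℤ -[1+ n ] = - (suc n × 1#)

  private
    x+y-[x+z]≈y-z : ∀ x y z → (x + y) - (x + z) ≈ y - z
    x+y-[x+z]≈y-z x y z = begin
      (x + y) - (x + z)    ≈⟨ +-congˡ (sym (-‿+-comm x z)) ⟩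
      (x + y) + (- x - z)  ≈⟨ sym (+-assoc _ _ _) ⟩
      (x + y) - x - z      ≈⟨ +-congʳ (xyx⁻¹≈y x y) ⟩
      y - z                ∎

  fromℤ-⊖ : ∀ m n → fromℤ (m ⊖ n) ≈ m × 1# - n × 1#
  fromℤ-⊖ m       zero    = sym (trans (+-congˡ -0#≈0#) (+-identityʳ _))
  fromℤ-⊖ zero    (suc n) = sym (+-identityˡ _)
  fromℤ-⊖ (suc m) (suc n) = begin
    fromℤ (suc m ⊖ suc n)        ≡⟨ ≡.cong fromℤ (ℤ.[1+m]⊖[1+n]≡m⊖n m n) ⟩
    fromℤ (m ⊖ n)                ≈⟨ fromℤ-⊖ m n ⟩
    m × 1# - n × 1#              ≈⟨ x+y-[x+z]≈y-z 1# _ _ ⟨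
    suc m × 1# - suc n × 1#      ∎

  fromℤ-+ : ∀ i j → fromℤ (i ℤ.+ j) ≈ fromℤ i + fromℤ j
  fromℤ-+ (+ m)    (+ n)    = ×-homo-+ 1# m n
  fromℤ-+ (+ m)    -[1+ n ] = fromℤ-⊖ m (suc n)
  fromℤ-+ -[1+ m ] (+ n)    = trans (fromℤ-⊖ n (suc m)) (+-comm _ _)
  fromℤ-+ -[1+ m ] -[1+ n ] = begin
    - (suc (suc (m ℕ.+ n)) × 1#)     ≡⟨ ≡.cong (λ k → - (suc k × 1#)) (ℕ.+-suc m n) ⟨
    - ((suc m ℕ.+ suc n) × 1#)       ≈⟨ -‿cong (×-homo-+ 1# (suc m) (suc n)) ⟩
    - (suc m × 1# + suc n × 1#)      ≈⟨ -‿+-comm _ _ ⟨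
    - (suc m × 1#) - (suc n × 1#)    ∎

  fromℤ-+◃ : ∀ n → fromℤ (Sign.+ ◃ n) ≈ n × 1#
  fromℤ-+◃ zero    = refl
  fromℤ-+◃ (suc n) = refl

  fromℤ-‿◃ : ∀ n → fromℤ (Sign.- ◃ n) ≈ - (n × 1#)
  fromℤ-‿◃ zero    = sym -0#≈0#
  fromℤ-‿◃ (suc n) = refl

  fromℤ-* : ∀ i j → fromℤ (i ℤ.* j) ≈ fromℤ i * fromℤ j
  fromℤ-* (+ m)    (+ n)    = trans (fromℤ-+◃ (m ℕ.* n)) (×1-homo-* m n)
  fromℤ-* (+ m)    -[1+ n ] = begin
    fromℤ (Sign.- ◃ (m ℕ.* suc n))  ≈⟨ fromℤ-‿◃ (m ℕ.* suc n) ⟩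
    - ((m ℕ.* suc n) × 1#)          ≈⟨ -‿cong (×1-homo-* m (suc n)) ⟩
    - (m × 1# * suc n × 1#)         ≈⟨ -‿distribʳ-* _ _ ⟩
    m × 1# * - (suc n × 1#)         ∎
  fromℤ-* -[1+ m ] (+ n)    = begin
    fromℤ (Sign.- ◃ (suc m ℕ.* n))  ≈⟨ fromℤ-‿◃ (suc m ℕ.* n) ⟩
    - ((suc m ℕ.* n) × 1#)          ≈⟨ -‿cong (×1-homo-* (suc m) n) ⟩
    - (suc m × 1# * n × 1#)         ≈⟨ -‿distribˡ-* _ _ ⟩
    - (suc m × 1#) * n × 1#         ∎
  fromℤ-* -[1+ m ] -[1+ n ] = begin
    (suc m ℕ.* suc n) × 1#          ≈⟨ ×1-homo-* (suc m) (suc n) ⟩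
    suc m × 1# * suc n × 1#         ≈⟨ -‿involutive _ ⟨
    - - (suc m × 1# * suc n × 1#)   ≈⟨ -‿cong (-‿distribˡ-* _ _) ⟩
    - (- (suc m × 1#) * suc n × 1#) ≈⟨ -‿distribʳ-* _ _ ⟩
    - (suc m × 1#) * - (suc n × 1#) ∎

  fromℤ-neg : ∀ i → fromℤ (ℤ.- i) ≈ - fromℤ i
  fromℤ-neg (+ zero)  = sym -0#≈0#
  fromℤ-neg (+ suc n) = refl
  fromℤ-neg -[1+ n ]  = sym (-‿involutive _)

  fromℤ-homomorphism : ℤ.+-*-rawRing -Raw-AlmostCommutative⟶ fromCommutativeRing R
  fromℤ-homomorphism = record
    { ⟦_⟧    = fromℤ
    ; +-homo = fromℤ-+
    ; *-homo = fromℤ-*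
    ; -‿homo = fromℤ-neg
    ; 0-homo = refl
    ; 1-homo = +-identityʳ 1#
    }

  fromℤ-≟ : ∀ i j → Maybe (fromℤ i ≈ fromℤ j)
  fromℤ-≟ i j = Maybe.map (reflexive ∘ ≡.cong fromℤ) (dec⇒maybe (i ℤ.≟ j))

  open RingSolver ℤ.+-*-rawRing (fromCommutativeRing R) fromℤ-homomorphism fromℤ-≟ public
    using (solve; _:=_; _:+_; _:-_; _:*_; :-_; con)

insert₀-cong : ∀ {m} j {π ρ : Permutation′ m} → π Perm.≈ ρ → insert zero j π Perm.≈ insert zero j ρ
insert₀-cong j eq zero    = ≡.refl
insert₀-cong j {π} {ρ} eq (suc i) = begin
  insert zero j π ⟨$⟩ʳ suc i  ≡⟨ insert-punchIn zero j π i ⟩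
  punchIn j (π ⟨$⟩ʳ i)        ≡⟨ ≡.cong (punchIn j) (eq i) ⟩
  punchIn j (ρ ⟨$⟩ʳ i)        ≡⟨ insert-punchIn zero j ρ i ⟨
  insert zero j ρ ⟨$⟩ʳ suc i  ∎
  where open ≡.≡-Reasoning

-- π ↦ (π 0 , remove 0 π) splits the permutations of Fin (suc m) by the image of 0.
∃-permutation? : ∀ {p} m {P : Permutation′ m → Set p} →
  P Respects Perm._≈_ → (∀ π → Dec (P π)) → Dec (∃ P)
∃-permutation? zero    resp P? = map′ (Perm.id ,_) (λ (π , Pπ) → resp (λ ()) Pπ) (P? Perm.id)
∃-permutation? (suc m) {P} resp P? = map′ fromInsert toInsert
  (any? λ j → ∃-permutation? m (λ eq → resp (insert₀-cong j eq)) (λ π → P? (insert zero j π)))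
  where
  fromInsert : (∃ λ j → ∃ λ π → P (insert zero j π)) → ∃ P
  fromInsert (j , π , P[insert]) = insert zero j π , P[insert]
  toInsert : ∃ P → ∃ λ j → ∃ λ π → P (insert zero j π)
  toInsert (π , Pπ) = π ⟨$⟩ʳ zero , remove zero π , resp (λ i → ≡.sym (insert-remove zero π i)) Pπ

module _ {c ℓ} (F : Field c ℓ) where
  open Field F hiding (zero)
  open EC F
  open RingProperties ring using (x∙y⁻¹≈ε⇒x≈y)
  open IntegerCoefficientSolver commutativeRing
  open ≈-Reasoning setoid

  IsAP-cong : ∀ {m} {v w : Fin (suc m) → Carrier} → (∀ i → v i ≈ w i) → IsAP m v → IsAP m w
  IsAP-cong v≈w (a , e , v≈a+ie) = a , e , λ i → trans (sym (v≈w i)) (v≈a+ie i)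

  IsAP-affine : ∀ {m} {v : Fin (suc m) → Carrier} α β → IsAP m v → IsAP m (λ i → α * v i + β)
  IsAP-affine {v = v} α β (a , e , v≈a+ie) = α * a + β , α * e , λ i → begin
    α * v i + β                            ≈⟨ +-congʳ (*-congˡ (v≈a+ie i)) ⟩
    α * (a + fromℕ (toℕ i) * e) + β
      ≈⟨ solve 5 (λ α β a k e → α :* (a :+ k :* e) :+ β := (α :* a :+ β) :+ k :* (α :* e))
                 refl α β a (fromℕ (toℕ i)) e ⟩
    (α * a + β) + fromℕ (toℕ i) * (α * e)  ∎

  IsAP-trivial : (v : Fin 1 → Carrier) → IsAP 0 v
  IsAP-trivial v = v zero , 0# , λ { zero → sym (trans (+-congˡ (zeroˡ 0#)) (+-identityʳ _)) }

  apDefect : ∀ {m} → (Fin (suc (suc m)) → Carrier) → Fin (suc (suc m)) → Carrier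
  apDefect v i = v i - v zero - fromℕ (toℕ i) * (v (suc zero) - v zero)

  IsAP⇒apDefect≈0 : ∀ {m} {v : Fin (suc (suc m)) → Carrier} →
    IsAP (suc m) v → ∀ i → apDefect v i ≈ 0#
  IsAP⇒apDefect≈0 (a , e , v≈a+ie) i = begin
    _  ≈⟨ +-cong (+-cong (v≈a+ie i) (-‿cong (v≈a+ie zero)))
                 (-‿cong (*-congˡ (+-cong (v≈a+ie (suc zero)) (-‿cong (v≈a+ie zero))))) ⟩
    _  ≈⟨ solve 3 (λ a k e → (a :+ k :* e) :- (a :+ con (+ 0) :* e)
                              :- k :* ((a :+ con (+ 1) :* e) :- (a :+ con (+ 0) :* e)) := con (+ 0))
                  refl a (fromℕ (toℕ i)) e ⟩
    0# ∎

  apDefect≈0⇒IsAP : ∀ {m} {v : Fin (suc (suc m)) → Carrier} →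
    (∀ i → apDefect v i ≈ 0#) → IsAP (suc m) v
  apDefect≈0⇒IsAP {v = v} defect≈0 = v zero , v (suc zero) - v zero , λ i → begin
    v i
      ≈⟨ solve 4 (λ vi v0 v1 k → vi := (v0 :+ k :* (v1 :- v0)) :+ ((vi :- v0) :- k :* (v1 :- v0)))
                 refl (v i) (v zero) (v (suc zero)) (fromℕ (toℕ i)) ⟩
    (v zero + fromℕ (toℕ i) * (v (suc zero) - v zero)) + apDefect v i ≈⟨ +-congˡ (defect≈0 i) ⟩
    (v zero + fromℕ (toℕ i) * (v (suc zero) - v zero)) + 0#           ≈⟨ +-identityʳ _ ⟩
    v zero + fromℕ (toℕ i) * (v (suc zero) - v zero)                  ∎

  apDefect-pencil : ∀ {m} (p q : Fin (suc (suc m)) → Carrier) r i →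
    apDefect (λ j → p j + r * q j) i ≈ apDefect p i + r * apDefect q i
  apDefect-pencil p q r i =
    solve 8 (λ pi p0 p1 qi q0 q1 r k →
               (pi :+ r :* qi) :- (p0 :+ r :* q0) :- k :* ((p1 :+ r :* q1) :- (p0 :+ r :* q0))
            := (pi :- p0 :- k :* (p1 :- p0)) :+ r :* (qi :- q0 :- k :* (q1 :- q0)))
      refl (p i) (p zero) (p (suc zero)) (q i) (q zero) (q (suc zero)) r (fromℕ (toℕ i))

  IsCommonRoot : ∀ {k} → (A B : Fin k → Carrier) → Carrier → Set ℓ
  IsCommonRoot A B r = ∀ i → A i + r * B i ≈ 0#

  IsCommonRoot-cong : ∀ {k} {A B : Fin k → Carrier} {r s} →
    r ≈ s → IsCommonRoot A B r → IsCommonRoot A B s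
  IsCommonRoot-cong r≈s isRoot i = trans (+-congˡ (*-congʳ (sym r≈s))) (isRoot i)

  linear-root-unique : ∀ {a b b⁻¹ r} → b * b⁻¹ ≈ 1# → a + r * b ≈ 0# → r ≈ - (a * b⁻¹)
  linear-root-unique {a} {b} {b⁻¹} {r} bb⁻¹≈1 a+rb≈0 = begin
    r                           ≈⟨ *-identityʳ r ⟨
    r * 1#                      ≈⟨ *-congˡ bb⁻¹≈1 ⟨
    r * (b * b⁻¹)
      ≈⟨ solve 4 (λ r b b⁻¹ a → r :* (b :* b⁻¹) := (a :+ r :* b) :* b⁻¹ :- a :* b⁻¹) refl r b b⁻¹ a ⟩
    (a + r * b) * b⁻¹ - a * b⁻¹ ≈⟨ +-congʳ (*-congʳ a+rb≈0) ⟩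
    0# * b⁻¹ - a * b⁻¹
      ≈⟨ solve 2 (λ b⁻¹ a → con (+ 0) :* b⁻¹ :- a :* b⁻¹ := :- (a :* b⁻¹)) refl b⁻¹ a ⟩
    - (a * b⁻¹)                 ∎

  ∃-common-root-via-candidate? : Decidable _≈_ → ∀ {k} {A B : Fin k → Carrier} r₀ →
    (∀ {r} → IsCommonRoot A B r → IsCommonRoot A B r₀) → Dec (∃ (IsCommonRoot A B))
  ∃-common-root-via-candidate? _≟_ {A = A} {B} r₀ reduce =
    map′ (r₀ ,_) (reduce ∘ proj₂) (all? λ i → (A i + r₀ * B i) ≟ 0#)

  -- If some B i ≉ 0, the only candidate is - A i / B i; otherwise r is a root iff 0 is.
  ∃-common-root? : Decidable _≈_ → ∀ {k} (A B : Fin k → Carrier) → Dec (∃ (IsCommonRoot A B))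
  ∃-common-root? _≟_ A B with any? (λ i → ¬? (B i ≟ 0#))
  ... | no ∄i[Bi≉0] = ∃-common-root-via-candidate? _≟_ 0# λ {r} isRoot i →
          trans (+-congˡ (trans (zeroˡ (B i)) (sym (trans (*-congˡ (Bi≈0 i)) (zeroʳ r))))) (isRoot i)
    where
    Bi≈0 : ∀ i → B i ≈ 0#
    Bi≈0 i = decidable-stable (B i ≟ 0#) (λ Bi≉0 → ∄i[Bi≉0] (i , Bi≉0))
  ... | yes (i , Bi≉0) with inverse (B i) Bi≉0
  ... | B⁻¹ , BB⁻¹≈1 = ∃-common-root-via-candidate? _≟_ (- (A i * B⁻¹)) λ isRoot →
          IsCommonRoot-cong (linear-root-unique BB⁻¹≈1 (isRoot i)) isRoot

  ∃-IsAP-pencil? : Decidable _≈_ → ∀ m (p q : Fin (suc m) → Carrier) →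
    Dec (∃ λ r → IsAP m (λ i → p i + r * q i))
  ∃-IsAP-pencil? _≟_ zero    p q = yes (0# , IsAP-trivial _)
  ∃-IsAP-pencil? _≟_ (suc m) p q =
    map′ (Product.map₂ λ isRoot → apDefect≈0⇒IsAP λ i → trans (apDefect-pencil p q _ i) (isRoot i))
         (Product.map₂ λ ap i → trans (sym (apDefect-pencil p q _ i)) (IsAP⇒apDefect≈0 ap i))
         (∃-common-root? _≟_ (apDefect p) (apDefect q))

  x*y≈0⇒x≈0⊎y≈0 : Decidable _≈_ → ∀ {x y} → x * y ≈ 0# → x ≈ 0# ⊎ y ≈ 0#
  x*y≈0⇒x≈0⊎y≈0 _≟_ {x} {y} xy≈0 with x ≟ 0#
  ... | yes x≈0 = inj₁ x≈0
  ... | no x≉0 with inverse x x≉0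
  ... | x⁻¹ , xx⁻¹≈1 = inj₂ (begin
    y              ≈⟨ *-identityˡ y ⟨
    1# * y         ≈⟨ *-congʳ xx⁻¹≈1 ⟨
    x * x⁻¹ * y    ≈⟨ solve 3 (λ x x⁻¹ y → x :* x⁻¹ :* y := x⁻¹ :* (x :* y)) refl x x⁻¹ y ⟩
    x⁻¹ * (x * y)  ≈⟨ *-congˡ xy≈0 ⟩
    x⁻¹ * 0#       ≈⟨ zeroʳ x⁻¹ ⟩
    0#             ∎)

  shear : Carrier → Change
  shear r = change 1# r 0# 0# (0≉1 ∘ sym)

  z≈1⇒z*z*z*y≈y : ∀ {z} → z ≈ 1# → ∀ y → z * z * z * y ≈ y
  z≈1⇒z*z*z*y≈y {z} z≈1 y = begin
    z * z * z * y     ≈⟨ *-congʳ (*-cong (*-cong z≈1 z≈1) z≈1) ⟩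
    1# * 1# * 1# * y  ≈⟨ *-congʳ (*-identityʳ (1# * 1#)) ⟩
    1# * 1# * y       ≈⟨ *-congʳ (*-identityˡ 1#) ⟩
    1# * y            ≈⟨ *-identityˡ y ⟩
    y                 ∎

  imgX-shear : ∀ r x y → imgX (shear r) x y ≈ x
  imgX-shear r x y = trans (+-identityʳ _) (trans (*-congʳ (*-identityˡ 1#)) (*-identityˡ x))

  imgY-shear : ∀ r x y → imgY (shear r) x y ≈ y + r * x
  imgY-shear r x y = trans (+-identityʳ _) (+-congʳ (z≈1⇒z*z*z*y≈y refl y))

  module _ (C : Change) where
    open Change C

    private
      u⁻¹ : Carrier
      u⁻¹ = proj₁ (inverse u u≉0)

    shearCoefficient : Carrier
    shearCoefficient = u⁻¹ * u⁻¹ * u⁻¹ * r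

    imgY-unshear : ∀ x y →
      y + shearCoefficient * x ≈ u⁻¹ * u⁻¹ * u⁻¹ * imgY C x y - u⁻¹ * u⁻¹ * u⁻¹ * t
    imgY-unshear x y = begin
      y + shearCoefficient * x
        ≈⟨ +-congʳ (z≈1⇒z*z*z*y≈y (proj₂ (inverse u u≉0)) y) ⟨
      u * u⁻¹ * (u * u⁻¹) * (u * u⁻¹) * y + shearCoefficient * x
        ≈⟨ solve 6 (λ u v y r x t → u :* v :* (u :* v) :* (u :* v) :* y :+ v :* v :* v :* r :* x
                                    := v :* v :* v :* (u :* u :* u :* y :+ r :* x :+ t) :- v :* v :* v :* t)
                   refl u u⁻¹ y r x t ⟩
      u⁻¹ * u⁻¹ * u⁻¹ * imgY C x y - u⁻¹ * u⁻¹ * u⁻¹ * t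
        ∎

    IsAP-imgY⇒IsAP-shear : ∀ {m} {xs ys : Fin (suc m) → Carrier} →
      IsAP m (λ i → imgY C (xs i) (ys i)) → IsAP m (λ i → ys i + shearCoefficient * xs i)
    IsAP-imgY⇒IsAP-shear ap = IsAP-cong (λ i → sym (imgY-unshear _ _)) (IsAP-affine _ _ ap)

  module _ (W : Weierstrass) where
    open Weierstrass W

    negY : Carrier → Carrier → Carrier
    negY x y = - y - a₁ * x - a₃

    OnCurve-negY : ∀ {x y} → OnCurve W x y → OnCurve W x (negY x y)
    OnCurve-negY {x} {y} = trans
      (solve 4 (λ y a x b → ((:- y) :- a :* x :- b) :* ((:- y) :- a :* x :- b)
                              :+ a :* x :* ((:- y) :- a :* x :- b) :+ b :* ((:- y) :- a :* x :- b)
                            := y :* y :+ a :* x :* y :+ b :* y)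
             refl y a₁ x a₃)

    OnCurve-fibre : Decidable _≈_ → ∀ {x y y′} →
      OnCurve W x y → OnCurve W x y′ → y′ ≈ y ⊎ y′ ≈ negY x y
    OnCurve-fibre _≟_ {x} {y} {y′} on on′ =
      Sum.map (x∙y⁻¹≈ε⇒x≈y _ _) (x∙y⁻¹≈ε⇒x≈y _ _) (x*y≈0⇒x≈0⊎y≈0 _≟_ (begin
        (y′ - y) * (y′ - negY x y)
          ≈⟨ solve 5 (λ y′ y a x b → (y′ :- y) :* (y′ :- ((:- y) :- a :* x :- b))
                                 := (y′ :* y′ :+ a :* x :* y′ :+ b :* y′) :- (y :* y :+ a :* x :* y :+ b :* y))
                     refl y′ y a₁ x a₃ ⟩
        (y′ * y′ + a₁ * x * y′ + a₃ * y′) - (y * y + a₁ * x * y + a₃ * y)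
          ≈⟨ +-cong on′ (-‿cong on) ⟩
        (x * x * x + a₂ * x * x + a₄ * x + a₆) - (x * x * x + a₂ * x * x + a₄ * x + a₆)
          ≈⟨ -‿inverseʳ _ ⟩
        0# ∎))

  module _ (W : Weierstrass) {n : ℕ} (x₀ d : Carrier)
           (pts : (i : Fin (suc n)) → Σ Carrier (OnCurve W (xAt x₀ d i))) where

    private
      X : Fin (suc n) → Carrier
      X i = xAt x₀ d i

    branch : Bool → Fin (suc n) → Carrier
    branch true  i = proj₁ (pts i)
    branch false i = negY W (X i) (proj₁ (pts i))

    -- b records the indices i at which the given point, not its negative, is chosen.
    chosenY : Subset (suc n) → Fin (suc n) → Carrier
    chosenY b i = branch (lookup b i) i

    OnCurve-chosenY : ∀ b i → OnCurve W (X i) (chosenY b i)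
    OnCurve-chosenY b i with lookup b i
    ... | true  = proj₂ (pts i)
    ... | false = OnCurve-negY W (proj₂ (pts i))

    OnCurve⇒≈chosenY : Decidable _≈_ → ∀ {ys : Fin (suc n) → Carrier} →
      (∀ i → OnCurve W (X i) (ys i)) → ∃ λ b → ∀ i → ys i ≈ chosenY b i
    OnCurve⇒≈chosenY _≟_ {ys} on = tabulate (proj₁ ∘ side) , λ i →
      ≡.subst (λ s → ys i ≈ branch s i) (≡.sym (lookup∘tabulate (proj₁ ∘ side) i)) (proj₂ (side i))
      where
      toBranch : ∀ {i y} → y ≈ branch true i ⊎ y ≈ branch false i → ∃ λ s → y ≈ branch s i
      toBranch (inj₁ y≈y₀)    = true , y≈y₀
      toBranch (inj₂ y≈negY₀) = false , y≈negY₀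
      side : ∀ i → ∃ λ s → ys i ≈ branch s i
      side i = toBranch (OnCurve-fibre W _≟_ (proj₂ (pts i)) (on i))

    ShearedAP : Subset (suc n) → Permutation′ (suc n) → Set (c ⊔ ℓ)
    ShearedAP b σ = ∃ λ r → IsAP n (λ i → chosenY b (σ ⟨$⟩ʳ i) + r * X (σ ⟨$⟩ʳ i))

    HasShearedAP : Set (c ⊔ ℓ)
    HasShearedAP = ∃ λ b → ∃ (ShearedAP b)

    ShearedAP-resp : ∀ b → ShearedAP b Respects Perm._≈_
    ShearedAP-resp b π≈ρ (r , ap) =
      r , IsAP-cong (λ i → reflexive (≡.cong (λ j → chosenY b j + r * X j) (π≈ρ i))) ap

    HasShearedAP? : Decidable _≈_ → Dec HasShearedAP
    HasShearedAP? _≟_ =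
      anySubset? λ b → ∃-permutation? (suc n) (λ {π} {ρ} → ShearedAP-resp b {π} {ρ}) λ σ →
        ∃-IsAP-pencil? _≟_ n (chosenY b ∘ (σ ⟨$⟩ʳ_)) (X ∘ (σ ⟨$⟩ʳ_))

    HasShearedAP⇒HasSAPWithSupport : ¬ d ≈ 0# → HasShearedAP → HasSAPWithSupport W n x₀ d
    HasShearedAP⇒HasSAPWithSupport d≉0 (b , σ , r , ap) =
      shear r , chosenY b , OnCurve-chosenY b ,
      (x₀ , d , d≉0 , λ i → imgX-shear r (X i) (chosenY b i)) ,
      σ , IsAP-cong (λ i → sym (imgY-shear r _ _)) ap

    HasSAPWithSupport⇒HasShearedAP : Decidable _≈_ → HasSAPWithSupport W n x₀ d → HasShearedAP
    HasSAPWithSupport⇒HasShearedAP _≟_ (C , ys , on , _ , σ , ap) =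
      let b , ys≈chosenY = OnCurve⇒≈chosenY _≟_ on
      in  b , σ , shearCoefficient C ,
          IsAP-cong (λ i → +-congʳ (ys≈chosenY (σ ⟨$⟩ʳ i))) (IsAP-imgY⇒IsAP-shear C ap)

theorem1 : ∀ {c ℓ} (F : Field c ℓ) →
    Decidable (Field._≈_ F) →
    (W : EC.Weierstrass F) → EC.IsElliptic F W →
    (n : ℕ) (x₀ d : Field.Carrier F) → ¬ (Field._≈_ F d (Field.0# F)) →
    ((i : Fin (suc n)) → Σ (Field.Carrier F) (EC.OnCurve F W (EC.xAt F x₀ d i))) →
    Dec (EC.HasSAPWithSupport F W n x₀ d)
theorem1 F _≟_ W _ n x₀ d d≉0 pts =
  map′ (HasShearedAP⇒HasSAPWithSupport F W x₀ d pts d≉0)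
       (HasSAPWithSupport⇒HasShearedAP F W x₀ d pts _≟_)
       (HasShearedAP? F W x₀ d pts _≟_)
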